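{- There is no non-trivial cycle of length less than $6$. If a non-trivial cycle of length $6$ exists, then, up to cyclic rotation, its terms have parities odd, odd, even, odd, odd, even.
   Context: The subprime Fibonacci rule: from positive integers $x,y$ with $s=x+y$, the next term is $s$ if $s$ is prime and $s/p$ if $s$ is composite, where $p$ is the smallest prime factor of $s$. A non-trivial cycle of length $m$ is an $m$-tuple $(t_1,\dots,t_m)$ of positive integers, indices read modulo $m$, such that for every $i$, $t_i$ is obtained from $t_{i-2},t_{i-1}$ by this rule, the $t_i$ are not all equal, and $m$ is the minimal period. -}

module Defs where

open import Data.Nat using (ℕ; zero; suc; _+_; _*_; _≤_; _<_; _%_)
open import Data.Nat.Divisibility using (_∣_)
open import Data.Nat.Primality using (Prime; Composite)
open import Data.Product using (_×_; Σ; ∃)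
open import Data.Sum using (_⊎_)
open import Relation.Binary.PropositionalEquality using (_≡_; _≢_)
open import Relation.Nullary using (¬_)

SmallestPrimeFactor : ℕ → ℕ → Set
SmallestPrimeFactor p s = Prime p × p ∣ s × (∀ q → Prime q → q ∣ s → p ≤ q)

SubprimeNext : ℕ → ℕ → ℕ → Set
SubprimeNext x y z =
  (Prime (x + y) × z ≡ x + y)
  ⊎ (Composite (x + y) × Σ ℕ (λ p → SmallestPrimeFactor p (x + y) × x + y ≡ p * z))

HasPeriod : (ℕ → ℕ) → ℕ → Set
HasPeriod t m = ∀ i → t (i + m) ≡ t i

-- A non-trivial cycle of length m: an m-tuple (t 0, …, t (m-1)), extended
-- m-periodically to all indices, of positive integers satisfying the rule at
-- every index, not all equal, with minimal period m.
NonTrivialCycle : ℕ → (ℕ → ℕ) → Set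
NonTrivialCycle m t =
  1 ≤ m
  × HasPeriod t m
  × (∀ i → 1 ≤ t i)
  × (∀ i → SubprimeNext (t i) (t (suc i)) (t (suc (suc i))))
  × (∃ λ i → ∃ λ j → t i ≢ t j)
  × (∀ d → 1 ≤ d → d < m → ¬ HasPeriod t d)

Odd Even : ℕ → Set
Odd n = n % 2 ≡ 1
Even n = n % 2 ≡ 0

-- Reduce mod 2. An even and an odd neighbour have an odd sum, whose smallest prime
-- factor is odd, so the next term is odd; two neighbours of equal parity are averaged,
-- the sum being even and, apart from 1 + 1, different from 2. A cycle that only ever
-- averages is constant, because the gap |tᵢ − tᵢ₊₁| halves at each step. Hence a
-- non-constant cycle has an even term, and no two adjacent even terms (an even pair
-- propagates backwards through the whole cycle), so every even term is followed by two
-- odd ones. For length at most 6 this leaves the parity patterns E Oᵏ with 2 ≤ k ≤ 5,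
-- and E O O E O O. In E Oᵏ the step equations (averages between odd terms, and at the
-- two mixed steps either no division or one by at least 3) contradict positivity and
-- primality.
module Submission where

open import Defs
open import Data.Empty using (⊥; ⊥-elim)
open import Data.List using (_∷_; [])
open import Data.Nat
  using (ℕ; zero; suc; _+_; _*_; _≤_; _<_; _%_; _/_; ∣_-_∣; z≤n; s≤s; nonTrivial⇒n>1)
open import Data.Nat.Properties
open import Data.Nat.DivMod using (%-distribˡ-+; %-distribˡ-*; m%n<n; m≡m%n+[m/n]*n)
open import Data.Nat.Divisibility using (_∣_; _∣?_; divides; m∣m*n; m%n≡0⇒n∣m)
open import Data.Nat.Primality
  using (Prime; prime[2]; ¬prime[1]; prime⇒irreducible; prime⇒nonTrivial; composite⇒¬prime)
open import Data.Nat.Tactic.RingSolver using (solve)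
open import Data.Product using (_×_; ∃; _,_; proj₁; proj₂)
open import Data.Sum using (_⊎_; inj₁; inj₂)
open import Function using (_∘_; case_of_)
open import Relation.Nullary using (¬_)
open import Relation.Nullary.Decidable using (from-no)
open import Relation.Binary.PropositionalEquality
  using (_≡_; _≢_; refl; sym; trans; cong; cong₂; subst; subst₂; module ≡-Reasoning)

private
  variable
    a b c d k m n p q x y z : ℕ
    t : ℕ → ℕ

parity : ∀ n → Even n ⊎ Odd n
parity zero          = inj₁ refl
parity (suc zero)    = inj₂ refl
parity (suc (suc n)) = parity n

even⇒¬odd : ∀ n → Even n → ¬ Odd n
even⇒¬odd _ even odd with trans (sym even) odd
... | ()

odd⇒pos : Odd n → 0 < n
odd⇒pos {suc n} _ = s≤s z≤n

even⇒2∣ : Even n → 2 ∣ n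
even⇒2∣ {n} = m%n≡0⇒n∣m n 2

even+odd : Even x → Odd y → Odd (x + y)
even+odd {x} {y} ex oy = trans (%-distribˡ-+ x y 2) (cong₂ (λ u v → (u + v) % 2) ex oy)

odd+even : Odd x → Even y → Odd (x + y)
odd+even {x} {y} ox ey = trans (%-distribˡ-+ x y 2) (cong₂ (λ u v → (u + v) % 2) ox ey)

odd+odd : Odd x → Odd y → Even (x + y)
odd+odd {x} {y} ox oy = trans (%-distribˡ-+ x y 2) (cong₂ (λ u v → (u + v) % 2) ox oy)

even+even : Even x → Even y → Even (x + y)
even+even {x} {y} ex ey = trans (%-distribˡ-+ x y 2) (cong₂ (λ u v → (u + v) % 2) ex ey)

m*even : ∀ m → Even n → Even (m * n)
m*even {n} m en = begin
  (m * n) % 2            ≡⟨ %-distribˡ-* m n 2 ⟩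
  (m % 2 * (n % 2)) % 2  ≡⟨ cong (λ v → (m % 2 * v) % 2) en ⟩
  (m % 2 * 0) % 2        ≡⟨ cong (_% 2) (*-zeroʳ (m % 2)) ⟩
  0                      ∎
  where open ≡-Reasoning

2*n-even : ∀ n → Even (2 * n)
2*n-even n = %-distribˡ-* 2 n 2

pos+pos≡2⇒≡1 : 0 < x → 0 < y → x + y ≡ 2 → x ≡ 1 × y ≡ 1
pos+pos≡2⇒≡1 {1}           {1}           _ _ _  = refl , refl
pos+pos≡2⇒≡1 {1}           {suc (suc _)} _ _ ()
pos+pos≡2⇒≡1 {suc (suc x)} {suc y}       _ _ eq
  with trans (sym (+-suc x y)) (suc-injective (suc-injective eq))
... | ()

data OddSumNext (x y z : ℕ) : Set where
  prime-sum     : Prime z → x + y ≡ z → OddSumNext x y z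
  composite-sum : 3 ≤ p → z ≢ 1 → x + y ≡ p * z → OddSumNext x y z

odd-sum-next : Odd (x + y) → SubprimeNext x y z → OddSumNext x y z
odd-sum-next _ (inj₁ (sum-prime , z≡sum)) =
  prime-sum (subst Prime (sym z≡sum) sum-prime) (sym z≡sum)
odd-sum-next {x} {y} {z} odd (inj₂ (sum-composite , p , (p-prime , _ , _) , sum≡p*z)) =
  composite-sum 3≤p z≢1 sum≡p*z
  where
  p≢2 : 2 ≢ p
  p≢2 refl = even⇒¬odd (x + y) (subst Even (sym sum≡p*z) (2*n-even z)) odd
  3≤p : 3 ≤ p
  3≤p = ≤∧≢⇒< (nonTrivial⇒n>1 p {{prime⇒nonTrivial p-prime}}) p≢2
  z≢1 : z ≢ 1
  z≢1 refl =
    composite⇒¬prime sum-composite (subst Prime (sym (trans sum≡p*z (*-identityʳ p))) p-prime)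

odd-sum-next-odd : Odd (x + y) → OddSumNext x y z → Odd z
odd-sum-next-odd odd (prime-sum _ sum≡z) = subst Odd sum≡z odd
odd-sum-next-odd {x} {y} {z} odd (composite-sum {p} _ _ sum≡p*z) with parity z
... | inj₂ oz = oz
... | inj₁ ez = ⊥-elim (even⇒¬odd (x + y) (subst Even (sym sum≡p*z) (m*even p ez)) odd)

¬odd-sum-next-1 : ¬ OddSumNext x y 1
¬odd-sum-next-1 (prime-sum 1-prime _)   = ¬prime[1] 1-prime
¬odd-sum-next-1 (composite-sum _ 1≢1 _) = 1≢1 refl

even-sum-next : Even (x + y) → SubprimeNext x y z → x + y ≡ 2 * z ⊎ (x + y ≡ 2 × z ≡ 2)
even-sum-next even (inj₁ (sum-prime , z≡sum))
  with prime⇒irreducible sum-prime (even⇒2∣ even)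
... | inj₂ 2≡sum = inj₂ (sym 2≡sum , trans z≡sum (sym 2≡sum))
even-sum-next {z = z} even (inj₂ (_ , p , (p-prime , _ , p-least) , sum≡p*z)) =
  inj₁ (trans sum≡p*z (cong (_* z) p≡2))
  where
  p≡2 : p ≡ 2
  p≡2 = ≤-antisym (p-least 2 prime[2] (even⇒2∣ even))
                  (nonTrivial⇒n>1 p {{prime⇒nonTrivial p-prime}})

even-odd-next : Even x → Odd y → SubprimeNext x y z → Odd z
even-odd-next {x} {y} ex oy step = odd-sum-next-odd {x} {y} odd (odd-sum-next {x} {y} odd step)
  where
  odd : Odd (x + y)
  odd = even+odd {x} {y} ex oy

odd-even-next : Odd x → Even y → SubprimeNext x y z → Odd z
odd-even-next {x} {y} ox ey step = odd-sum-next-odd {x} {y} odd (odd-sum-next {x} {y} odd step)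
  where
  odd : Odd (x + y)
  odd = odd+even {x} {y} ox ey

odds-halve : Odd x → Odd y → Odd z → SubprimeNext x y z → x + y ≡ 2 * z
odds-halve {x} {y} {z} ox oy oz step with even-sum-next {x} {y} (odd+odd {x} {y} ox oy) step
... | inj₁ halving    = halving
... | inj₂ (_ , refl) = ⊥-elim (even⇒¬odd 2 refl oz)

evens-halve : Even x → Even y → 0 < x → 0 < y → SubprimeNext x y z → x + y ≡ 2 * z
evens-halve {x} {y} ex ey x>0 y>0 step with even-sum-next {x} {y} (even+even {x} {y} ex ey) step
... | inj₁ halving    = halving
... | inj₂ (sum≡2 , _) with pos+pos≡2⇒≡1 x>0 y>0 sum≡2
...   | refl , _ = ⊥-elim (even⇒¬odd 1 ex refl)

SubprimeSequence : (ℕ → ℕ) → Set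
SubprimeSequence t = ∀ i → SubprimeNext (t i) (t (suc i)) (t (suc (suc i)))

NonConstant : (ℕ → ℕ) → Set
NonConstant t = ∃ λ i → ∃ λ j → t i ≢ t j

nonConstant⇒¬constant : NonConstant t → ¬ (∀ i → t i ≡ t 0)
nonConstant⇒¬constant (i , j , tᵢ≢tⱼ) constant =
  tᵢ≢tⱼ (trans (constant i) (sym (constant j)))

periodic-shift : HasPeriod t m → ∀ i k → t (i + k * m) ≡ t i
periodic-shift {t} per i zero    = cong t (+-identityʳ i)
periodic-shift {t} {m} per i (suc k) = begin
  t (i + (m + k * m))  ≡⟨ cong (λ j → t (i + j)) (+-comm m (k * m)) ⟩
  t (i + (k * m + m))  ≡⟨ cong t (sym (+-assoc i (k * m) m)) ⟩
  t (i + k * m + m)    ≡⟨ per (i + k * m) ⟩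
  t (i + k * m)        ≡⟨ periodic-shift per i k ⟩
  t i                  ∎
  where open ≡-Reasoning

periodic-mod : HasPeriod t (suc k) → ∀ i → t i ≡ t (i % suc k)
periodic-mod {t} {k} per i =
  trans (cong t (m≡m%n+[m/n]*n i (suc k))) (periodic-shift per (i % suc k) (i / suc k))

periodic-extend : (P : ℕ → Set) → HasPeriod t (suc k) →
  (∀ i → i < suc k → P (t i)) → ∀ i → P (t i)
periodic-extend {k = k} P per below i =
  subst P (sym (periodic-mod per i)) (below (i % suc k) (m%n<n i (suc k)))

halving-gap : ∀ a b c → a + b ≡ 2 * c → ∣ a - b ∣ ≡ 2 * ∣ b - c ∣
halving-gap a b c a+b≡2c = sym (begin
  2 * ∣ b - c ∣          ≡⟨ *-distribˡ-∣-∣ 2 b c ⟩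
  ∣ 2 * b - 2 * c ∣      ≡⟨ cong₂ ∣_-_∣ (*-comm 2 b) (sym a+b≡2c) ⟩
  ∣ b * 2 - a + b ∣      ≡⟨ cong₂ ∣_-_∣ (*-suc b 1) (+-comm a b) ⟩
  ∣ b + b * 1 - b + a ∣  ≡⟨ ∣m+n-m+o∣≡∣n-o∣ b (b * 1) a ⟩
  ∣ b * 1 - a ∣          ≡⟨ cong ∣_- a ∣ (*-identityʳ b) ⟩
  ∣ b - a ∣              ≡⟨ ∣-∣-comm b a ⟩
  ∣ a - b ∣              ∎)
  where open ≡-Reasoning

2*n≤n⇒n≡0 : 2 * n ≤ n → n ≡ 0
2*n≤n⇒n≡0 {zero}  _     = refl
2*n≤n⇒n≡0 {suc n} 2n≤n = ⊥-elim (m+1+n≰m (suc n) 2n≤n)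

-- The gap |t i − t (i+1)| halves at every step, so periodicity forces it to vanish.
halving⇒constant : HasPeriod t (suc k) →
  (∀ i → t i + t (suc i) ≡ 2 * t (suc (suc i))) → ∀ i → t i ≡ t 0
halving⇒constant {t} {k} per halving = constant
  where
  gap : ℕ → ℕ
  gap i = ∣ t i - t (suc i) ∣

  gap-halves : ∀ i → gap i ≡ 2 * gap (suc i)
  gap-halves i = halving-gap (t i) (t (suc i)) (t (suc (suc i))) (halving i)

  gap-antitone : ∀ j i → gap (j + i) ≤ gap i
  gap-antitone zero    i = ≤-refl
  gap-antitone (suc j) i =
    ≤-trans (subst (gap (suc (j + i)) ≤_) (sym (gap-halves (j + i))) (m≤m+n _ _))
            (gap-antitone j i)

  gap-periodic : ∀ i → gap i ≤ gap (suc i)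
  gap-periodic i = begin
    gap i            ≡⟨ sym (cong₂ ∣_-_∣ (per i) (per (suc i))) ⟩
    gap (i + suc k)  ≡⟨ cong gap (trans (+-suc i k) (sym (+-comm k (suc i)))) ⟩
    gap (k + suc i)  ≤⟨ gap-antitone k (suc i) ⟩
    gap (suc i)      ∎
    where open ≤-Reasoning

  gap-zero : ∀ i → gap i ≡ 0
  gap-zero i = trans (gap-halves i) (cong (2 *_) next-zero)
    where
    next-zero : gap (suc i) ≡ 0
    next-zero = 2*n≤n⇒n≡0 (subst (_≤ gap (suc i)) (gap-halves i) (gap-periodic i))

  constant : ∀ i → t i ≡ t 0
  constant zero    = refl
  constant (suc i) = trans (sym (∣m-n∣≡0⇒m≡n (gap-zero i))) (constant i)

even-or-odds-below : ∀ (s : ℕ → ℕ) n →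
  (∃ λ r → Even (s r)) ⊎ (∀ i → i < n → Odd (s i))
even-or-odds-below s zero = inj₂ λ _ ()
even-or-odds-below s (suc n) with even-or-odds-below s n | parity (s n)
... | inj₁ found | _         = inj₁ found
... | inj₂ _     | inj₁ even = inj₁ (n , even)
... | inj₂ odds  | inj₂ odd  = inj₂ λ i i<1+n → case m<1+n⇒m<n∨m≡n i<1+n of λ where
  (inj₁ i<n)  → odds i i<n
  (inj₂ refl) → odd

module _ {s : ℕ → ℕ} (rule : SubprimeSequence s) where

  odd-after-even-odd : ∀ i → Even (s i) → Odd (s (suc i)) → Odd (s (suc (suc i)))
  odd-after-even-odd i eᵢ oᵢ₊₁ = even-odd-next {s i} {s (suc i)} eᵢ oᵢ₊₁ (rule i)

  even-before-evens : ∀ i → Even (s (suc i)) → Even (s (suc (suc i))) → Even (s i)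
  even-before-evens i e₁ e₂ with parity (s i)
  ... | inj₁ e₀ = e₀
  ... | inj₂ o₀ =
    ⊥-elim (even⇒¬odd (s (suc (suc i))) e₂ (odd-even-next {s i} {s (suc i)} o₀ e₁ (rule i)))

  even-pair-downward : ∀ d i → Even (s (d + i)) → Even (s (suc (d + i))) → Even (s i)
  even-pair-downward zero    i e₀ _  = e₀
  even-pair-downward (suc d) i e₁ e₂ =
    even-pair-downward d i (even-before-evens (d + i) e₁ e₂) e₁

  all-odd⇒constant : HasPeriod s (suc k) → (∀ i → Odd (s i)) → ∀ i → s i ≡ s 0
  all-odd⇒constant per odd = halving⇒constant per λ i →
    odds-halve {s i} {s (suc i)} (odd i) (odd (suc i)) (odd (suc (suc i))) (rule i)

  all-even⇒constant : HasPeriod s (suc k) → (∀ i → 0 < s i) →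
    (∀ i → Even (s i)) → ∀ i → s i ≡ s 0
  all-even⇒constant per pos even = halving⇒constant per λ i →
    evens-halve {s i} {s (suc i)} (even i) (even (suc i)) (pos i) (pos (suc i)) (rule i)

  -- Shift the pair by j periods, so that it lies above j and can be walked down to it.
  even-pair⇒all-even : HasPeriod s (suc k) →
    ∀ r → Even (s r) → Even (s (suc r)) → ∀ j → Even (s j)
  even-pair⇒all-even {k} per r e₀ e₁ j =
    even-pair-downward (r + j * k) j
      (subst Even (cong s index) e₀') (subst Even (cong (s ∘ suc) index) e₁')
    where
    index : r + j * suc k ≡ r + j * k + j
    index = trans (cong (r +_) (trans (*-suc j k) (+-comm j (j * k)))) (sym (+-assoc r (j * k) j))
    e₀' : Even (s (r + j * suc k))
    e₀' = subst Even (sym (periodic-shift per r j)) e₀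
    e₁' : Even (s (suc r + j * suc k))
    e₁' = subst Even (sym (periodic-shift per (suc r) j)) e₁

  even-isolated : HasPeriod s (suc k) → (∀ i → 0 < s i) → NonConstant s →
    ∀ i → Even (s i) → Odd (s (suc i))
  even-isolated per pos nonConstant i eᵢ with parity (s (suc i))
  ... | inj₂ o = o
  ... | inj₁ e = ⊥-elim (nonConstant⇒¬constant nonConstant
                   (all-even⇒constant per pos (even-pair⇒all-even per i eᵢ e)))

  even-term : HasPeriod s (suc k) → NonConstant s → ∃ λ r → Even (s r)
  even-term {k} per nonConstant with even-or-odds-below s (suc k)
  ... | inj₁ found = found
  ... | inj₂ odds  = ⊥-elim (nonConstant⇒¬constant nonConstant
                       (all-odd⇒constant per (periodic-extend Odd per odds)))

  step-into-start : HasPeriod s (suc (suc n)) → SubprimeNext (s n) (s (suc n)) (s 0)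
  step-into-start {n} per = subst (SubprimeNext (s n) (s (suc n))) (per 0) (rule n)

  step-across-start : HasPeriod s (suc n) → SubprimeNext (s n) (s 0) (s 1)
  step-across-start {n} per = subst₂ (SubprimeNext (s n)) (per 0) (per 1) (rule n)

infixl 6 _⊕_
_⊕_ : a ≡ b → c ≡ d → a + c ≡ b + d
_⊕_ = cong₂ _+_

infix 7 _⊛_
_⊛_ : ∀ k → a ≡ b → k * a ≡ k * b
k ⊛ a≡b = cong (k *_) a≡b

-- A linear combination A ≡ B of hypotheses gives L ≡ R once L − R = A − B identically.
combine : ∀ {L R A B} → A ≡ B → L + B ≡ R + A → L ≡ R
combine {L} {R} {A} {B} A≡B identity = +-cancelʳ-≡ B L R (trans identity (cong (R +_) A≡B))

pos⇒+≢0 : 0 < a → a + b ≢ 0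
pos⇒+≢0 {a} a>0 a+b≡0 = <⇒≢ a>0 (sym (m+n≡0⇒m≡0 a a+b≡0))

2*b+2*a<p*b+q*a : 3 ≤ p → 3 ≤ q → 0 < a → 2 * b + 2 * a < p * b + q * a
2*b+2*a<p*b+q*a {p} {q} {a} {b} 3≤p 3≤q a>0 = begin-strict
  2 * b + 2 * a              <⟨ m<m+n (2 * b + 2 * a) (<-≤-trans a>0 (m≤n+m a b)) ⟩
  2 * b + 2 * a + (b + a)    ≡⟨ solve (a ∷ b ∷ []) ⟩
  3 * b + 3 * a              ≤⟨ +-mono-≤ (*-monoˡ-≤ b 3≤p) (*-monoˡ-≤ a 3≤q) ⟩
  p * b + q * a              ∎
  where open ≤-Reasoning

2≤c⇒prime[c*a]⇒a≡1 : ∀ c → 2 ≤ c → Prime (c * a) → a ≡ 1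
2≤c⇒prime[c*a]⇒a≡1 {a} (suc (suc c)) (s≤s (s≤s _)) prime[c*a]
  with prime⇒irreducible prime[c*a] (m∣m*n {suc (suc c)} a)
... | inj₂ c≡c*a = sym (*-cancelˡ-≡ 1 a (suc (suc c)) (trans (*-identityʳ _) c≡c*a))

m∤n⇒n*a≢m*[q*a] : ∀ q → ¬ m ∣ n → 0 < a → n * a ≢ m * (q * a)
m∤n⇒n*a≢m*[q*a] {m} {n} {suc a} q m∤n _ na≡m[qa] =
  m∤n (divides q (trans n≡mq (*-comm m q)))
  where
  n≡mq : n ≡ m * q
  n≡mq = *-cancelʳ-≡ n (m * q) (suc a) (trans na≡m[qa] (sym (*-assoc m q (suc a))))

-- Summing all step equations settles the prime–prime and composite–composite cases;
-- in the mixed cases a combination eliminating e and the middle terms leaves a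
-- relation between o₁ and o₂ alone.
module _ {e o₁ o₂ : ℕ} where

  EO²-arithmetic : 0 < o₁ → OddSumNext e o₁ o₂ → o₁ + o₂ ≡ 2 * e → OddSumNext o₂ e o₁ → ⊥
  EO²-arithmetic o₁>0 (prime-sum _ x) l (prime-sum _ y) = pos⇒+≢0 o₁>0 sum
    where
    sum : o₁ + o₂ ≡ 0
    sum = combine (x ⊕ l ⊕ y) (solve (e ∷ o₁ ∷ o₂ ∷ []))
  EO²-arithmetic o₁>0 (composite-sum {p} 3≤p _ x) l (composite-sum {q} 3≤q _ y) =
    <⇒≢ (2*b+2*a<p*b+q*a 3≤p 3≤q o₁>0) sum
    where
    sum : 2 * o₂ + 2 * o₁ ≡ p * o₂ + q * o₁
    sum = combine (x ⊕ l ⊕ y) (solve (e ∷ o₁ ∷ o₂ ∷ p ∷ q ∷ []))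
  EO²-arithmetic _ (prime-sum o₂-prime x) l (composite-sum _ o₁≢1 _) =
    o₁≢1 (2≤c⇒prime[c*a]⇒a≡1 3 (s≤s (s≤s z≤n)) (subst Prime (sym 3o₁≡o₂) o₂-prime))
    where
    3o₁≡o₂ : 3 * o₁ ≡ o₂
    3o₁≡o₂ = combine (2 ⊛ x ⊕ l) (solve (e ∷ o₁ ∷ o₂ ∷ []))
  EO²-arithmetic _ (composite-sum _ o₂≢1 _) l (prime-sum o₁-prime y) =
    o₂≢1 (2≤c⇒prime[c*a]⇒a≡1 3 (s≤s (s≤s z≤n)) (subst Prime (sym 3o₂≡o₁) o₁-prime))
    where
    3o₂≡o₁ : 3 * o₂ ≡ o₁
    3o₂≡o₁ = combine (l ⊕ 2 ⊛ y) (solve (e ∷ o₁ ∷ o₂ ∷ []))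

module _ {e o₁ o₂ o₃ : ℕ} where

  EO³-arithmetic : 0 < o₁ → OddSumNext e o₁ o₂ →
    o₁ + o₂ ≡ 2 * o₃ → o₂ + o₃ ≡ 2 * e → OddSumNext o₃ e o₁ → ⊥
  EO³-arithmetic o₁>0 (prime-sum _ x) h₁ l (prime-sum _ y) = pos⇒+≢0 o₁>0 sum
    where
    sum : o₁ + o₂ ≡ 0
    sum = combine (x ⊕ h₁ ⊕ l ⊕ y) (solve (e ∷ o₁ ∷ o₂ ∷ o₃ ∷ []))
  EO³-arithmetic o₁>0 (composite-sum {p} 3≤p _ x) h₁ l (composite-sum {q} 3≤q _ y) =
    <⇒≢ (2*b+2*a<p*b+q*a 3≤p 3≤q o₁>0) sum
    where
    sum : 2 * o₂ + 2 * o₁ ≡ p * o₂ + q * o₁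
    sum = combine (x ⊕ h₁ ⊕ l ⊕ y) (solve (e ∷ o₁ ∷ o₂ ∷ o₃ ∷ p ∷ q ∷ []))
  EO³-arithmetic _ (prime-sum o₂-prime x) h₁ l (composite-sum _ o₁≢1 _) =
    o₁≢1 (2≤c⇒prime[c*a]⇒a≡1 5 (s≤s (s≤s z≤n)) (subst Prime (sym 5o₁≡o₂) o₂-prime))
    where
    5o₁≡o₂ : 5 * o₁ ≡ o₂
    5o₁≡o₂ = combine (4 ⊛ x ⊕ h₁ ⊕ 2 ⊛ l) (solve (e ∷ o₁ ∷ o₂ ∷ o₃ ∷ []))
  EO³-arithmetic _ (composite-sum _ o₂≢1 _) h₁ l (prime-sum o₁-prime y) =
    o₂≢1 (2≤c⇒prime[c*a]⇒a≡1 5 (s≤s (s≤s z≤n)) (subst Prime (sym 5o₂≡o₁) o₁-prime))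
    where
    5o₂≡o₁ : 5 * o₂ ≡ o₁
    5o₂≡o₁ = combine (3 ⊛ h₁ ⊕ 2 ⊛ l ⊕ 4 ⊛ y) (solve (e ∷ o₁ ∷ o₂ ∷ o₃ ∷ []))

module _ {e o₁ o₂ o₃ o₄ : ℕ} where

  EO⁴-arithmetic : 0 < o₁ → 0 < o₂ → OddSumNext e o₁ o₂ →
    o₁ + o₂ ≡ 2 * o₃ → o₂ + o₃ ≡ 2 * o₄ → o₃ + o₄ ≡ 2 * e → OddSumNext o₄ e o₁ → ⊥
  EO⁴-arithmetic o₁>0 _ (prime-sum _ x) h₁ h₂ l (prime-sum _ y) = pos⇒+≢0 o₁>0 sum
    where
    sum : o₁ + o₂ ≡ 0
    sum = combine (x ⊕ h₁ ⊕ h₂ ⊕ l ⊕ y) (solve (e ∷ o₁ ∷ o₂ ∷ o₃ ∷ o₄ ∷ []))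
  EO⁴-arithmetic o₁>0 _ (composite-sum {p} 3≤p _ x) h₁ h₂ l (composite-sum {q} 3≤q _ y) =
    <⇒≢ (2*b+2*a<p*b+q*a 3≤p 3≤q o₁>0) sum
    where
    sum : 2 * o₂ + 2 * o₁ ≡ p * o₂ + q * o₁
    sum = combine (x ⊕ h₁ ⊕ h₂ ⊕ l ⊕ y) (solve (e ∷ o₁ ∷ o₂ ∷ o₃ ∷ o₄ ∷ p ∷ q ∷ []))
  EO⁴-arithmetic o₁>0 _ (prime-sum _ x) h₁ h₂ l (composite-sum {q} _ _ y) =
    m∤n⇒n*a≢m*[q*a] q (from-no (3 ∣? 17)) o₁>0 17o₁≡3qo₁
    where
    17o₁≡3qo₁ : 17 * o₁ ≡ 3 * (q * o₁)
    17o₁≡3qo₁ = combine (11 ⊛ x ⊕ 6 ⊛ h₁ ⊕ 5 ⊛ h₂ ⊕ 7 ⊛ l ⊕ 3 ⊛ y)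
                        (solve (e ∷ o₁ ∷ o₂ ∷ o₃ ∷ o₄ ∷ q ∷ []))
  EO⁴-arithmetic _ o₂>0 (composite-sum {p} _ _ x) h₁ h₂ l (prime-sum _ y) =
    m∤n⇒n*a≢m*[q*a] p (from-no (3 ∣? 17)) o₂>0 17o₂≡3po₂
    where
    17o₂≡3po₂ : 17 * o₂ ≡ 3 * (p * o₂)
    17o₂≡3po₂ = combine (3 ⊛ x ⊕ 8 ⊛ h₁ ⊕ 9 ⊛ h₂ ⊕ 7 ⊛ l ⊕ 11 ⊛ y)
                        (solve (e ∷ o₁ ∷ o₂ ∷ o₃ ∷ o₄ ∷ p ∷ []))

module _ {e o₁ o₂ o₃ o₄ o₅ : ℕ} where

  EO⁵-arithmetic : 0 < o₁ → 0 < o₂ → OddSumNext e o₁ o₂ →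
    o₁ + o₂ ≡ 2 * o₃ → o₂ + o₃ ≡ 2 * o₄ → o₃ + o₄ ≡ 2 * o₅ → o₄ + o₅ ≡ 2 * e →
    OddSumNext o₅ e o₁ → ⊥
  EO⁵-arithmetic o₁>0 _ (prime-sum _ x) h₁ h₂ h₃ l (prime-sum _ y) = pos⇒+≢0 o₁>0 sum
    where
    sum : o₁ + o₂ ≡ 0
    sum = combine (x ⊕ h₁ ⊕ h₂ ⊕ h₃ ⊕ l ⊕ y) (solve (e ∷ o₁ ∷ o₂ ∷ o₃ ∷ o₄ ∷ o₅ ∷ []))
  EO⁵-arithmetic o₁>0 _ (composite-sum {p} 3≤p _ x) h₁ h₂ h₃ l (composite-sum {q} 3≤q _ y) =
    <⇒≢ (2*b+2*a<p*b+q*a 3≤p 3≤q o₁>0) sum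
    where
    sum : 2 * o₂ + 2 * o₁ ≡ p * o₂ + q * o₁
    sum = combine (x ⊕ h₁ ⊕ h₂ ⊕ h₃ ⊕ l ⊕ y)
                  (solve (e ∷ o₁ ∷ o₂ ∷ o₃ ∷ o₄ ∷ o₅ ∷ p ∷ q ∷ []))
  EO⁵-arithmetic o₁>0 _ (prime-sum _ x) h₁ h₂ h₃ l (composite-sum {q} _ _ y) =
    m∤n⇒n*a≢m*[q*a] q (from-no (5 ∣? 31)) o₁>0 31o₁≡5qo₁
    where
    31o₁≡5qo₁ : 31 * o₁ ≡ 5 * (q * o₁)
    31o₁≡5qo₁ = combine (21 ⊛ x ⊕ 10 ⊛ h₁ ⊕ 11 ⊛ h₂ ⊕ 9 ⊛ h₃ ⊕ 13 ⊛ l ⊕ 5 ⊛ y)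
                        (solve (e ∷ o₁ ∷ o₂ ∷ o₃ ∷ o₄ ∷ o₅ ∷ q ∷ []))
  EO⁵-arithmetic _ o₂>0 (composite-sum {p} _ _ x) h₁ h₂ h₃ l (prime-sum _ y) =
    m∤n⇒n*a≢m*[q*a] p (from-no (5 ∣? 31)) o₂>0 31o₂≡5po₂
    where
    31o₂≡5po₂ : 31 * o₂ ≡ 5 * (p * o₂)
    31o₂≡5po₂ = combine (5 ⊛ x ⊕ 16 ⊛ h₁ ⊕ 15 ⊛ h₂ ⊕ 17 ⊛ h₃ ⊕ 13 ⊛ l ⊕ 21 ⊛ y)
                        (solve (e ∷ o₁ ∷ o₂ ∷ o₃ ∷ o₄ ∷ o₅ ∷ p ∷ []))

halving-ones : a + b ≡ 2 * c → b ≡ 1 → c ≡ 1 → a ≡ 1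
halving-ones {a} a+1≡2 refl refl = +-cancelʳ-≡ 1 a 1 a+1≡2

module _ {s : ℕ → ℕ} (rule : SubprimeSequence s) where

  odds-halve-at : ∀ i → Odd (s i) → Odd (s (suc i)) → Odd (s (suc (suc i))) →
    s i + s (suc i) ≡ 2 * s (suc (suc i))
  odds-halve-at i o₀ o₁ o₂ = odds-halve {s i} {s (suc i)} o₀ o₁ o₂ (rule i)

  odd-sum-at-start : Even (s 0) → Odd (s 1) → OddSumNext (s 0) (s 1) (s 2)
  odd-sum-at-start e₀ o₁ = odd-sum-next {s 0} {s 1} (even+odd {s 0} {s 1} e₀ o₁) (rule 0)

  odd-sum-across-start : HasPeriod s (suc n) → Even (s 0) → Odd (s n) →
    OddSumNext (s n) (s 0) (s 1)
  odd-sum-across-start {n} per e₀ oₙ =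
    odd-sum-next {s n} {s 0} (odd+even {s n} {s 0} oₙ e₀) (step-across-start rule per)

  halving-into-start : HasPeriod s (suc (suc n)) → Odd (s n) → Odd (s (suc n)) →
    s n + s (suc n) ≡ 2 * s 0 ⊎ (s n ≡ 1 × s (suc n) ≡ 1)
  halving-into-start {n} per oₙ oₙ₊₁
    with even-sum-next {s n} {s (suc n)} (odd+odd {s n} {s (suc n)} oₙ oₙ₊₁)
                       (step-into-start rule per)
  ... | inj₁ halving    = inj₁ halving
  ... | inj₂ (sum≡2 , _) = inj₂ (pos+pos≡2⇒≡1 (odd⇒pos oₙ) (odd⇒pos oₙ₊₁) sum≡2)

  odd-sum-at-start-≢1 : Even (s 0) → Odd (s 1) → s 2 ≢ 1
  odd-sum-at-start-≢1 e₀ o₁ s₂≡1 =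
    ¬odd-sum-next-1 (subst (OddSumNext (s 0) (s 1)) s₂≡1 (odd-sum-at-start e₀ o₁))

  ¬cycle-EO² : HasPeriod s 3 → Even (s 0) → Odd (s 1) → Odd (s 2) → ⊥
  ¬cycle-EO² per e₀ o₁ o₂ with halving-into-start per o₁ o₂
  ... | inj₁ l          =
    EO²-arithmetic (odd⇒pos o₁) (odd-sum-at-start e₀ o₁) l (odd-sum-across-start per e₀ o₂)
  ... | inj₂ (_ , s₂≡1) = odd-sum-at-start-≢1 e₀ o₁ s₂≡1

  ¬cycle-EO³ : HasPeriod s 4 → Even (s 0) → Odd (s 1) → Odd (s 2) → Odd (s 3) → ⊥
  ¬cycle-EO³ per e₀ o₁ o₂ o₃ with halving-into-start per o₂ o₃
  ... | inj₁ l          = EO³-arithmetic (odd⇒pos o₁) (odd-sum-at-start e₀ o₁)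
                            (odds-halve-at 1 o₁ o₂ o₃) l (odd-sum-across-start per e₀ o₃)
  ... | inj₂ (s₂≡1 , _) = odd-sum-at-start-≢1 e₀ o₁ s₂≡1

  ¬cycle-EO⁴ : HasPeriod s 5 → Even (s 0) →
    Odd (s 1) → Odd (s 2) → Odd (s 3) → Odd (s 4) → ⊥
  ¬cycle-EO⁴ per e₀ o₁ o₂ o₃ o₄ with halving-into-start per o₃ o₄
  ... | inj₁ l = EO⁴-arithmetic (odd⇒pos o₁) (odd⇒pos o₂) (odd-sum-at-start e₀ o₁)
                   (odds-halve-at 1 o₁ o₂ o₃) (odds-halve-at 2 o₂ o₃ o₄) l
                   (odd-sum-across-start per e₀ o₄)
  ... | inj₂ (s₃≡1 , s₄≡1) =
    odd-sum-at-start-≢1 e₀ o₁ (halving-ones (odds-halve-at 2 o₂ o₃ o₄) s₃≡1 s₄≡1)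

  ¬cycle-EO⁵ : HasPeriod s 6 → Even (s 0) →
    Odd (s 1) → Odd (s 2) → Odd (s 3) → Odd (s 4) → Odd (s 5) → ⊥
  ¬cycle-EO⁵ per e₀ o₁ o₂ o₃ o₄ o₅ with halving-into-start per o₄ o₅
  ... | inj₁ l = EO⁵-arithmetic (odd⇒pos o₁) (odd⇒pos o₂) (odd-sum-at-start e₀ o₁)
                   (odds-halve-at 1 o₁ o₂ o₃) (odds-halve-at 2 o₂ o₃ o₄)
                   (odds-halve-at 3 o₃ o₄ o₅) l (odd-sum-across-start per e₀ o₅)
  ... | inj₂ (s₄≡1 , s₅≡1) = odd-sum-at-start-≢1 e₀ o₁ s₂≡1
    where
    s₃≡1 : s 3 ≡ 1
    s₃≡1 = halving-ones (odds-halve-at 3 o₃ o₄ o₅) s₄≡1 s₅≡1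
    s₂≡1 : s 2 ≡ 1
    s₂≡1 = halving-ones (odds-halve-at 2 o₂ o₃ o₄) s₃≡1 s₄≡1

OOEOOE-at : (ℕ → ℕ) → ℕ → Set
OOEOOE-at t r = Odd (t r) × Odd (t (r + 1)) × Even (t (r + 2))
              × Odd (t (r + 3)) × Odd (t (r + 4)) × Even (t (r + 5))

module _ {s : ℕ → ℕ} (rule : SubprimeSequence s)
         (isolated : ∀ i → Even (s i) → Odd (s (suc i))) where

  odds-after-even : ∀ i → Even (s i) → Odd (s (suc i)) × Odd (s (suc (suc i)))
  odds-after-even i eᵢ = oᵢ₊₁ , odd-after-even-odd {s} rule i eᵢ oᵢ₊₁
    where
    oᵢ₊₁ : Odd (s (suc i))
    oᵢ₊₁ = isolated i eᵢ

  ¬odd-at-period : HasPeriod s m → Even (s 0) → ¬ Odd (s m)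
  ¬odd-at-period per e₀ oₘ = even⇒¬odd (s 0) e₀ (subst Odd (per 0) oₘ)

  even-start-shape : ∀ k → HasPeriod s (suc k) → Even (s 0) →
    suc k ≤ 6 → suc k ≡ 6 × Even (s 3)
  even-start-shape 0 per e₀ _ = ⊥-elim (¬odd-at-period per e₀ (isolated 0 e₀))
  even-start-shape 1 per e₀ _ = ⊥-elim (¬odd-at-period per e₀ (proj₂ (odds-after-even 0 e₀)))
  even-start-shape 2 per e₀ _ with odds-after-even 0 e₀
  ... | o₁ , o₂ = ⊥-elim (¬cycle-EO² rule per e₀ o₁ o₂)
  even-start-shape 3 per e₀ _ with odds-after-even 0 e₀ | parity (s 3)
  ... | _       | inj₁ e₃ = ⊥-elim (¬odd-at-period per e₀ (isolated 3 e₃))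
  ... | o₁ , o₂ | inj₂ o₃ = ⊥-elim (¬cycle-EO³ rule per e₀ o₁ o₂ o₃)
  even-start-shape 4 per e₀ _ with odds-after-even 0 e₀ | parity (s 3) | parity (s 4)
  ... | _       | inj₁ e₃ | _       =
    ⊥-elim (¬odd-at-period per e₀ (proj₂ (odds-after-even 3 e₃)))
  ... | _       | inj₂ _  | inj₁ e₄ = ⊥-elim (¬odd-at-period per e₀ (isolated 4 e₄))
  ... | o₁ , o₂ | inj₂ o₃ | inj₂ o₄ = ⊥-elim (¬cycle-EO⁴ rule per e₀ o₁ o₂ o₃ o₄)
  even-start-shape 5 per e₀ _
    with odds-after-even 0 e₀ | parity (s 3) | parity (s 4) | parity (s 5)
  ... | _       | inj₁ e₃ | _       | _       = refl , e₃
  ... | _       | inj₂ _  | inj₁ e₄ | _       =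
    ⊥-elim (¬odd-at-period per e₀ (proj₂ (odds-after-even 4 e₄)))
  ... | _       | inj₂ _  | inj₂ _  | inj₁ e₅ = ⊥-elim (¬odd-at-period per e₀ (isolated 5 e₅))
  ... | o₁ , o₂ | inj₂ o₃ | inj₂ o₄ | inj₂ o₅ = ⊥-elim (¬cycle-EO⁵ rule per e₀ o₁ o₂ o₃ o₄ o₅)
  even-start-shape (suc (suc (suc (suc (suc (suc _)))))) _ _
    (s≤s (s≤s (s≤s (s≤s (s≤s (s≤s ()))))))

  even-start-OOEOOE : HasPeriod s 6 → Even (s 0) → Even (s 3) → OOEOOE-at s 1
  even-start-OOEOOE per e₀ e₃ with odds-after-even 0 e₀ | odds-after-even 3 e₃
  ... | o₁ , o₂ | o₄ , o₅ = o₁ , o₂ , e₃ , o₄ , o₅ , subst Even (sym (per 0)) e₀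

rotate-period : HasPeriod t m → ∀ r → HasPeriod (λ i → t (i + r)) m
rotate-period {t} {m} per r i = trans (cong t index) (per (i + r))
  where
  index : i + m + r ≡ i + r + m
  index = trans (+-assoc i m r) (trans (cong (i +_) (+-comm m r)) (sym (+-assoc i r m)))

rotate-OOEOOE : ∀ t r → OOEOOE-at (λ i → t (i + r)) 1 → OOEOOE-at t (suc r)
rotate-OOEOOE t r (o₀ , o₁ , e₂ , o₃ , o₄ , e₅) =
  o₀ , subst Odd (index 1) o₁ , subst Even (index 2) e₂ , subst Odd (index 3) o₃ ,
  subst Odd (index 4) o₄ , subst Even (index 5) e₅
  where
  index : ∀ j → t (suc j + r) ≡ t (suc r + j)
  index j = cong (t ∘ suc) (+-comm j r)

corollary7 : (m : ℕ) (t : ℕ → ℕ) → NonTrivialCycle m t →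
    6 ≤ m
    × (m ≡ 6 → ∃ λ r → Odd (t r) × Odd (t (r + 1)) × Even (t (r + 2))
                      × Odd (t (r + 3)) × Odd (t (r + 4)) × Even (t (r + 5)))
corollary7 zero    t (() , _)
corollary7 (suc k) t (_ , per , pos , rule , nonConstant , _) = 6≤m , six⇒OOEOOE
  where
  start : ∃ λ r → Even (t r)
  start = even-term rule per nonConstant

  r : ℕ
  r = proj₁ start

  s : ℕ → ℕ
  s i = t (i + r)

  s-rule : SubprimeSequence s
  s-rule i = rule (i + r)

  s-isolated : ∀ i → Even (s i) → Odd (s (suc i))
  s-isolated i = even-isolated rule per pos nonConstant (i + r)

  shape : suc k ≤ 6 → suc k ≡ 6 × Even (s 3)
  shape = even-start-shape s-rule s-isolated k (rotate-period per r) (proj₂ start)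

  6≤m : 6 ≤ suc k
  6≤m = ≮⇒≥ λ m<6 → <⇒≢ m<6 (proj₁ (shape (<⇒≤ m<6)))

  six⇒OOEOOE : suc k ≡ 6 → ∃ (OOEOOE-at t)
  six⇒OOEOOE m≡6 = suc r , rotate-OOEOOE t r (even-start-OOEOOE s-rule s-isolated
    (subst (HasPeriod s) m≡6 (rotate-period per r)) (proj₂ start)
    (proj₂ (shape (≤-reflexive m≡6))))
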